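{- Let $q\ge2$ and let $\mathbf f\in A_q^+$ with $|\mathbf f|\ge2$ be a forbidden factor that does not induce zero periodicity on $A_q^\infty$ and is not of the form $0^\ell$ or $(q-1)0^\ell$ for any $\ell\ge1$. Let $n\ge1$ and let $\mathbf a$, $\mathbf b$ be two consecutive words ($\mathbf a$ immediately preceding $\mathbf b$) in $A_q^n(\mathbf f)$ listed in the appropriate order, and let $k$ be the leftmost position where they differ. Let $\mathbf a'=a_1\cdots a_k$ and $\mathbf b'=b_1\cdots b_k$ be their length-$k$ prefixes, let $\mathbf a''$ be the last word of $\mathbf a'|A_q^\infty(\mathbf f)$ and $\mathbf b''$ the first word of $\mathbf b'|A_q^\infty(\mathbf f)$, in the appropriate order. Then at most one of $\mathbf a''$, $\mathbf b''$ does not have ultimate period $0$.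
   Context: $A_q=\{0,1,\dots,q-1\}$. $A_q^n$ is the set of length-$n$ words, $A_q^*$ (resp. $A_q^+$) the set of all (resp. nonempty) finite words, $A_q^\infty$ the right-infinite words; $|\mathbf f|$ is the length; $x^\ell$ is $\ell$ repetitions. For a set $X$ of words, $X(\mathbf f)$ is the set of words of $X$ not containing $\mathbf f$ as a factor (contiguous subword), $\mathbf p|X$ the words of $X$ with prefix $\mathbf p$. An infinite word has ultimate period $\mathbf c\ne\epsilon$ if it equals $\mathbf b\mathbf c^\infty$ for a finite $\mathbf b$, where $\mathbf c^\infty=\mathbf c\mathbf c\cdots$. For distinct words $\mathbf s,\mathbf t$ of the same (finite or infinite) length, with $k$ the leftmost differing position, $u=\sum_{i<k}s_i$, $v$ the number of nonzero symbols among $s_1,\dots,s_{k-1}$: $\mathbf s\prec\mathbf t$ iff ($u$ even and $s_k<t_k$) or ($u$ odd and $s_k>t_k$); $\mathbf s\triangleleft\mathbf t$ iff ($u+v$ even and $s_k<t_k$) or ($u+v$ odd and $s_k>t_k$). The appropriate order is $\prec$ for even $q$ and $\triangleleft$ for odd $q$; first/last mean least/greatest in it. $\mathbf f$ induces zero periodicity on $A_q^\infty$ if for every $\mathbf p\in A_q^*(\mathbf f)$ the first and last words of $\mathbf p|A_q^\infty(\mathbf f)$ both have ultimate period $0$. -}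

module Defs where

open import Data.Nat using (ℕ; zero; suc; _+_; _≤_; _<_; _%_; s≤s; z≤n)
open import Data.Fin using (Fin; toℕ; fromℕ<)
open import Data.List using (List; []; _∷_; _++_; length; replicate)
open import Data.Product using (Σ; ∃; _×_; _,_)
open import Data.Sum using (_⊎_)
open import Relation.Binary.PropositionalEquality using (_≡_; _≢_)
open import Relation.Nullary using (¬_)

-- Alphabet A_q = Fin q (symbol i ↔ the number i).
-- Finite words: List (Fin q).  Right-infinite words: ℕ → Fin q (position 0 is the first symbol).
Word : ℕ → Set
Word q = List (Fin q)

InfWord : ℕ → Set
InfWord q = ℕ → Fin q

sym0 : {q : ℕ} → 2 ≤ q → Fin q
sym0 {suc q} _ = fromℕ< (s≤s z≤n)

symLast : {q : ℕ} → 2 ≤ q → Fin q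
symLast {suc q} _ = fromℕ< (s≤s (Data.Nat.Properties.≤-refl))
  where import Data.Nat.Properties

take∞ : {q : ℕ} → ℕ → InfWord q → Word q
take∞ zero    w = []
take∞ (suc n) w = w 0 ∷ take∞ n (λ i → w (suc i))

drop∞ : {q : ℕ} → ℕ → InfWord q → InfWord q
drop∞ j w = λ i → w (j + i)

FactorOf : {q : ℕ} → Word q → Word q → Set
FactorOf f w = ∃ λ u → ∃ λ v → w ≡ u ++ f ++ v

FactorOf∞ : {q : ℕ} → Word q → InfWord q → Set
FactorOf∞ f w = ∃ λ j → take∞ (length f) (drop∞ j w) ≡ f

Avoids : {q : ℕ} → Word q → Word q → Set
Avoids f w = ¬ FactorOf f w

Avoids∞ : {q : ℕ} → Word q → InfWord q → Set
Avoids∞ f w = ¬ FactorOf∞ f w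

InCyl : {q : ℕ} → Word q → Word q → InfWord q → Set
InCyl f p w = take∞ (length p) w ≡ p × Avoids∞ f w

-- u = sum of symbols, v = number of nonzero symbols
symSum : {q : ℕ} → Word q → ℕ
symSum []       = 0
symSum (x ∷ xs) = toℕ x + symSum xs

nonZeros : {q : ℕ} → Word q → ℕ
nonZeros []       = 0
nonZeros (x ∷ xs) with toℕ x
... | zero  = nonZeros xs
... | suc _ = suc (nonZeros xs)

-- parity key of the common prefix for the appropriate order:
-- q even: u (order ≺);  q odd: u + v (order ◁)
key : (q : ℕ) → Word q → ℕ
key q p with q % 2
... | zero  = symSum p
... | suc _ = symSum p + nonZeros p

Decide : (q : ℕ) → Word q → Fin q → Fin q → Set
Decide q p x y =
  (key q p % 2 ≡ 0 × toℕ x < toℕ y) ⊎ (key q p % 2 ≡ 1 × toℕ y < toℕ x)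

Prec : (q : ℕ) → Word q → Word q → Set
Prec q s t = ∃ λ p → ∃ λ x → ∃ λ y → ∃ λ s' → ∃ λ t' →
  s ≡ p ++ x ∷ s' × t ≡ p ++ y ∷ t' × length s' ≡ length t' × x ≢ y × Decide q p x y

Prec∞ : (q : ℕ) → InfWord q → InfWord q → Set
Prec∞ q s t = ∃ λ k → take∞ k s ≡ take∞ k t × s k ≢ t k × Decide q (take∞ k s) (s k) (t k)

_≐_ : {q : ℕ} → InfWord q → InfWord q → Set
s ≐ t = ∀ i → s i ≡ t i

IsFirst : (q : ℕ) → Word q → Word q → InfWord q → Set
IsFirst q f p w = InCyl f p w × (∀ z → InCyl f p z → z ≐ w ⊎ Prec∞ q w z)

IsLast : (q : ℕ) → Word q → Word q → InfWord q → Set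
IsLast q f p w = InCyl f p w × (∀ z → InCyl f p z → z ≐ w ⊎ Prec∞ q z w)

UltPeriod0 : {q : ℕ} → 2 ≤ q → InfWord q → Set
UltPeriod0 h w = ∃ λ m → ∀ i → m ≤ i → w i ≡ sym0 h

InducesZeroPeriodicity : (q : ℕ) → 2 ≤ q → Word q → Set
InducesZeroPeriodicity q h f =
  ∀ p → Avoids f p →
    (∀ w → IsFirst q f p w → UltPeriod0 h w) × (∀ w → IsLast q f p w → UltPeriod0 h w)

Consecutive : (q n : ℕ) → Word q → Word q → Word q → Set
Consecutive q n f a b =
  length a ≡ n × Avoids f a × length b ≡ n × Avoids f b × Prec q a b ×
  (∀ c → length c ≡ n → Avoids f c → ¬ (Prec q a c × Prec q c b))

module Submission where

-- Write r = p x for the prefix of the cylinder whose last word is a'',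
-- and 0 for the symbol 0.  Among the symbols 0 and q-1 exactly one, cA, makes the
-- parity key of r cA odd; then cA is the greatest symbol after r and every later 0
-- is the greatest symbol after its prefix, so the candidate r cA 0^∞ is the greatest
-- infinite word with prefix r.  If it avoided f it would be a'', which therefore would
-- have ultimate period 0.  Hence f occurs in p x cA 0^∞, and dually in p y cB 0^∞
-- (cB chosen with even key, making the candidate least).  Since a = p x s avoids f and
-- f is neither 0^ℓ nor (q-1)0^ℓ, each occurrence straddles the two positions |p| and
-- |p|+1.  Comparing the two occurrences of the same word f: equal starts force x = y;
-- otherwise one candidate, say the first, has cA = 0 and x ∈ {0, q-1}.  Then the parity
-- of the key of p makes x the greatest symbol after p, contradicting a ≺ b.

open import Defs
open import Data.Nat using (ℕ; zero; suc; _+_; _≤_; _<_; _%_; s≤s; z≤n; s≤s⁻¹)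
open import Data.Nat.Properties
  using (0≢1+n; 1+n≰n; +-assoc; +-suc; +-comm; +-identityʳ; +-monoʳ-≤; +-monoˡ-<; <-cmp; ≰⇒>; ≮⇒≥;
         _≤?_; _<?_; m≤n⇒∃[o]m+o≡n; m<1+n⇒m≤n; ≤-refl; ≤-trans; ≤-reflexive)
open import Data.Nat.DivMod using (%-distribˡ-+; m%n<n)
open import Data.Nat.Tactic.RingSolver using (solve-∀)
open import Data.Fin using (Fin; toℕ)
open import Data.Fin.Properties using (toℕ-fromℕ<; toℕ<n)
open import Data.List using (List; []; _∷_; _++_; length; replicate)
open import Data.List.Properties using (++-assoc; ++-identityʳ; ∷-injectiveˡ; ∷-injectiveʳ; length-++)
open import Data.Product using (_×_; _,_; ∃-syntax)
open import Data.Sum using (_⊎_; inj₁; inj₂)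
open import Data.Empty using (⊥; ⊥-elim)
open import Relation.Binary using (tri<; tri≈; tri>)
open import Relation.Binary.PropositionalEquality
open import Relation.Nullary using (¬_; yes; no)

symSum-++ : ∀ {q} (u v : Word q) → symSum (u ++ v) ≡ symSum u + symSum v
symSum-++ []      v = refl
symSum-++ (x ∷ u) v = trans (cong (toℕ x +_) (symSum-++ u v)) (sym (+-assoc (toℕ x) (symSum u) (symSum v)))

nonZeros-++ : ∀ {q} (u v : Word q) → nonZeros (u ++ v) ≡ nonZeros u + nonZeros v
nonZeros-++ []      v = refl
nonZeros-++ (x ∷ u) v with toℕ x
... | zero  = nonZeros-++ u v
... | suc _ = cong suc (nonZeros-++ u v)

key-++ : ∀ q (u v : Word q) → key q (u ++ v) ≡ key q u + key q v
key-++ q u v with q % 2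
... | zero  = symSum-++ u v
... | suc _ = trans (cong₂ _+_ (symSum-++ u v) (nonZeros-++ u v))
                    (interchange (symSum u) (symSum v) (nonZeros u) (nonZeros v))
  where
    interchange : ∀ a b c d → (a + b) + (c + d) ≡ (a + c) + (b + d)
    interchange = solve-∀

parity-cases : ∀ n → n % 2 ≡ 0 ⊎ n % 2 ≡ 1
parity-cases n with n % 2 | m%n<n n 2
... | 0           | _                 = inj₁ refl
... | 1           | _                 = inj₂ refl
... | suc (suc _) | s≤s (s≤s ())

first-difference-unique : ∀ {A : Set} (p p' : List A) {x y x' y' s t s' t'} →
  p ++ x ∷ s ≡ p' ++ x' ∷ s' → p ++ y ∷ t ≡ p' ++ y' ∷ t' → x ≢ y → x' ≢ y' →
  p ≡ p' × x ≡ x' × y ≡ y'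
first-difference-unique []      []      ea eb _  _    = refl , ∷-injectiveˡ ea , ∷-injectiveˡ eb
first-difference-unique []      (_ ∷ _) ea eb xy _    = ⊥-elim (xy (trans (∷-injectiveˡ ea) (sym (∷-injectiveˡ eb))))
first-difference-unique (_ ∷ _) []      ea eb _  x'y' = ⊥-elim (x'y' (trans (sym (∷-injectiveˡ ea)) (∷-injectiveˡ eb)))
first-difference-unique (_ ∷ p) (_ ∷ p') ea eb xy x'y'
  with first-difference-unique p p' (∷-injectiveʳ ea) (∷-injectiveʳ eb) xy x'y'
... | refl , ex , ey = cong (_∷ p) (∷-injectiveˡ ea) , ex , ey

prec-at-first-difference : ∀ {q} {a b p s t} {x y : Fin q} → Prec q a b →
  a ≡ p ++ x ∷ s → b ≡ p ++ y ∷ t → x ≢ y → Decide q p x y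
prec-at-first-difference {p = p} (p₀ , x₀ , y₀ , s₀ , t₀ , ea₀ , eb₀ , _ , x₀y₀ , D) ea eb xy
  with first-difference-unique p p₀ (trans (sym ea) ea₀) (trans (sym eb) eb₀) xy x₀y₀
... | refl , refl , refl = D

take∞-cong : ∀ {q} n {w w' : InfWord q} → w ≐ w' → take∞ n w ≡ take∞ n w'
take∞-cong zero    e = refl
take∞-cong (suc n) e = cong₂ _∷_ (e 0) (take∞-cong n (λ i → e (suc i)))

take∞-agree : ∀ {q} n (w w' : InfWord q) → take∞ n w ≡ take∞ n w' → ∀ k → k < n → w k ≡ w' k
take∞-agree (suc n) w w' e zero    _        = ∷-injectiveˡ e
take∞-agree (suc n) w w' e (suc k) (s≤s lt) =
  take∞-agree n (λ i → w (suc i)) (λ i → w' (suc i)) (∷-injectiveʳ e) k lt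

take∞-+ : ∀ {q} a b (w : InfWord q) → take∞ (a + b) w ≡ take∞ a w ++ take∞ b (drop∞ a w)
take∞-+ zero    b w = refl
take∞-+ (suc a) b w = cong (w 0 ∷_) (take∞-+ a b (λ i → w (suc i)))

occurrence-in-prefix : ∀ {q} {f : Word q} {w : InfWord q} j n → j + length f ≤ n →
  take∞ (length f) (drop∞ j w) ≡ f → FactorOf f (take∞ n w)
occurrence-in-prefix {q} {f} {w} j n le occ with m≤n⇒∃[o]m+o≡n le
... | e , refl = take∞ j w , rest , (begin
  take∞ (j + length f + e) w                              ≡⟨ take∞-+ (j + length f) e w ⟩
  take∞ (j + length f) w ++ rest                          ≡⟨ cong (_++ rest) (take∞-+ j (length f) w) ⟩
  (take∞ j w ++ take∞ (length f) (drop∞ j w)) ++ rest   ≡⟨ cong (λ u → (take∞ j w ++ u) ++ rest) occ ⟩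
  (take∞ j w ++ f) ++ rest                                ≡⟨ ++-assoc (take∞ j w) f rest ⟩
  take∞ j w ++ f ++ rest                                  ∎)
  where
    open ≡-Reasoning
    rest : Word q
    rest = take∞ e (drop∞ (j + length f) w)

factor-extend : ∀ {q} {f u : Word q} (s : Word q) → FactorOf f u → FactorOf f (u ++ s)
factor-extend {f = f} s (l , r , refl) =
  l , r ++ s , trans (++-assoc l (f ++ r) s) (cong (l ++_) (++-assoc f r s))

difference-beyond-prefix : ∀ {q} (r : Word q) {w z : InfWord q} {k} →
  take∞ (length r) w ≡ r → take∞ (length r) z ≡ r → w k ≢ z k → ∃[ d ] length r + d ≡ k
difference-beyond-prefix r {w} {z} {k} pw pz differ with k <? length r
... | yes k<r = ⊥-elim (differ (take∞-agree (length r) w z (trans pw (sym pz)) k k<r))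
... | no  k≮r = m≤n⇒∃[o]m+o≡n (≮⇒≥ k≮r)

UltPeriod0-resp : ∀ {q} {h : 2 ≤ q} {w w' : InfWord q} → w ≐ w' → UltPeriod0 h w → UltPeriod0 h w'
UltPeriod0-resp e (m , zeros) = m , λ i le → trans (sym (e i)) (zeros i le)

module Alphabet (m : ℕ) where

  Q : ℕ
  Q = suc (suc m)

  hQ : 2 ≤ Q
  hQ = s≤s (s≤s z≤n)

  𝟘 𝟙 : Fin Q
  𝟘 = sym0 hQ
  𝟙 = symLast hQ

  toℕ-𝟙 : toℕ 𝟙 ≡ suc m
  toℕ-𝟙 = toℕ-fromℕ< (s≤s (≤-refl {suc m}))

  𝟙-maximal : ∀ (d : Fin Q) → ¬ (toℕ 𝟙 < toℕ d)
  𝟙-maximal d lt = 1+n≰n (≤-trans (subst (λ u → suc u ≤ toℕ d) toℕ-𝟙 lt) (s≤s⁻¹ (toℕ<n d)))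

  zeroPad : Word Q → InfWord Q
  zeroPad []      _       = 𝟘
  zeroPad (h ∷ u) zero    = h
  zeroPad (h ∷ u) (suc i) = zeroPad u i

  zeroPad-shift : ∀ (u v : Word Q) i → zeroPad (u ++ v) (length u + i) ≡ zeroPad v i
  zeroPad-shift []      v i = refl
  zeroPad-shift (h ∷ u) v i = zeroPad-shift u v i

  zeroPad-ultPeriod0 : ∀ (u : Word Q) → UltPeriod0 hQ (zeroPad u)
  zeroPad-ultPeriod0 u = length u , beyond u
    where
      beyond : ∀ (u : Word Q) i → length u ≤ i → zeroPad u i ≡ 𝟘
      beyond []      i       _        = refl
      beyond (h ∷ u) (suc i) (s≤s le) = beyond u i le

  take∞-zeroPad : ∀ (u v : Word Q) d → take∞ (length u + d) (zeroPad (u ++ v)) ≡ u ++ take∞ d (zeroPad v)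
  take∞-zeroPad []      v d = refl
  take∞-zeroPad (h ∷ u) v d = cong (h ∷_) (take∞-zeroPad u v d)

  take∞-zeroPad-prefix : ∀ (u v : Word Q) → take∞ (length u) (zeroPad (u ++ v)) ≡ u
  take∞-zeroPad-prefix []      v = refl
  take∞-zeroPad-prefix (h ∷ u) v = cong (h ∷_) (take∞-zeroPad-prefix u v)

  take∞-zeros : ∀ d → take∞ d (zeroPad []) ≡ replicate d 𝟘
  take∞-zeros zero    = refl
  take∞-zeros (suc d) = cong (𝟘 ∷_) (take∞-zeros d)

  key-pad : ∀ (u : Word Q) d → key Q (u ++ replicate d 𝟘) ≡ key Q u
  key-pad u d = trans (key-++ Q u (replicate d 𝟘)) (trans (cong (key Q u +_) key-zeros) (+-identityʳ _))
    where
      symSum-zeros : ∀ d → symSum (replicate d 𝟘) ≡ 0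
      symSum-zeros zero    = refl
      symSum-zeros (suc d) = symSum-zeros d
      nonZeros-zeros : ∀ d → nonZeros (replicate d 𝟘) ≡ 0
      nonZeros-zeros zero    = refl
      nonZeros-zeros (suc d) = nonZeros-zeros d
      key-zeros : key Q (replicate d 𝟘) ≡ 0
      key-zeros with Q % 2
      ... | zero  = symSum-zeros d
      ... | suc _ = cong₂ _+_ (symSum-zeros d) (nonZeros-zeros d)

  key-snoc-𝟘 : ∀ (r : Word Q) → key Q (r ++ 𝟘 ∷ []) % 2 ≡ key Q r % 2
  key-snoc-𝟘 r = cong (_% 2) (key-pad r 1)

  nonZeros-𝟙 : nonZeros (𝟙 ∷ []) ≡ 1
  nonZeros-𝟙 with toℕ 𝟙 | toℕ-𝟙
  ... | suc _ | _ = refl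

  -- 𝟙 = suc m has odd key: for even Q the number suc m is odd, for odd Q it is even and nonzero.
  key-𝟙-odd : key Q (𝟙 ∷ []) % 2 ≡ 1
  key-𝟙-odd with Q % 2 in eq
  ... | zero = begin
    (toℕ 𝟙 + 0) % 2 ≡⟨ cong (λ u → (u + 0) % 2) toℕ-𝟙 ⟩
    (suc m + 0) % 2 ≡⟨ cong (_% 2) (+-identityʳ (suc m)) ⟩
    suc m % 2       ≡⟨ suc-of-even m eq ⟩
    1               ∎
    where
      open ≡-Reasoning
      suc-of-even : ∀ n → n % 2 ≡ 0 → suc n % 2 ≡ 1
      suc-of-even zero          _ = refl
      suc-of-even (suc zero)    ()
      suc-of-even (suc (suc n)) e = suc-of-even n e
  ... | suc _ with parity-cases m
  ...   | inj₁ even = ⊥-elim (0≢1+n (trans (sym even) eq))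
  ...   | inj₂ odd  = begin
    (toℕ 𝟙 + 0 + nonZeros (𝟙 ∷ [])) % 2 ≡⟨ cong₂ (λ u v → (u + 0 + v) % 2) toℕ-𝟙 nonZeros-𝟙 ⟩
    (suc m + 0 + 1) % 2                  ≡⟨ cong (λ u → (u + 1) % 2) (+-identityʳ (suc m)) ⟩
    (suc m + 1) % 2                      ≡⟨ cong (_% 2) (+-comm (suc m) 1) ⟩
    m % 2                                ≡⟨ odd ⟩
    1                                    ∎
    where open ≡-Reasoning

  key-snoc-𝟙 : ∀ (r : Word Q) {b} → key Q r % 2 ≡ b → key Q (r ++ 𝟙 ∷ []) % 2 ≡ (b + 1) % 2
  key-snoc-𝟙 r {b} e = begin
    key Q (r ++ 𝟙 ∷ []) % 2                  ≡⟨ cong (_% 2) (key-++ Q r (𝟙 ∷ [])) ⟩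
    (key Q r + key Q (𝟙 ∷ [])) % 2           ≡⟨ %-distribˡ-+ (key Q r) (key Q (𝟙 ∷ [])) 2 ⟩
    (key Q r % 2 + key Q (𝟙 ∷ []) % 2) % 2   ≡⟨ cong₂ (λ u v → (u + v) % 2) e key-𝟙-odd ⟩
    (b + 1) % 2                              ∎
    where open ≡-Reasoning

  Top Bottom : Word Q → Fin Q → Set
  Top    r c = ∀ d → ¬ Decide Q r c d
  Bottom r c = ∀ d → ¬ Decide Q r d c

  𝟘-top : ∀ {r} → key Q r % 2 ≡ 1 → Top r 𝟘
  𝟘-top odd d (inj₁ (even , _)) = 0≢1+n (trans (sym even) odd)
  𝟘-top odd d (inj₂ (_ , ()))

  𝟘-bottom : ∀ {r} → key Q r % 2 ≡ 0 → Bottom r 𝟘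
  𝟘-bottom even d (inj₁ (_ , ()))
  𝟘-bottom even d (inj₂ (odd , _)) = 0≢1+n (trans (sym even) odd)

  𝟙-top : ∀ {r} → key Q r % 2 ≡ 0 → Top r 𝟙
  𝟙-top even d (inj₁ (_ , lt))  = 𝟙-maximal d lt
  𝟙-top even d (inj₂ (odd , _)) = 0≢1+n (trans (sym even) odd)

  𝟙-bottom : ∀ {r} → key Q r % 2 ≡ 1 → Bottom r 𝟙
  𝟙-bottom odd d (inj₁ (even , _)) = 0≢1+n (trans (sym even) odd)
  𝟙-bottom odd d (inj₂ (_ , lt))   = 𝟙-maximal d lt

  Extreme : Fin Q → Set
  Extreme c = c ≡ 𝟘 ⊎ c ≡ 𝟙

  extreme-top : ∀ {r c} → Extreme c → key Q (r ++ c ∷ []) % 2 ≡ 1 → Top r c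
  extreme-top {r} (inj₁ refl) odd = 𝟘-top (trans (sym (key-snoc-𝟘 r)) odd)
  extreme-top {r} (inj₂ refl) odd with parity-cases (key Q r)
  ... | inj₁ even = 𝟙-top even
  ... | inj₂ odd' = ⊥-elim (0≢1+n (trans (sym (key-snoc-𝟙 r odd')) odd))

  extreme-bottom : ∀ {r c} → Extreme c → key Q (r ++ c ∷ []) % 2 ≡ 0 → Bottom r c
  extreme-bottom {r} (inj₁ refl) even = 𝟘-bottom (trans (sym (key-snoc-𝟘 r)) even)
  extreme-bottom {r} (inj₂ refl) even with parity-cases (key Q r)
  ... | inj₁ even' = ⊥-elim (0≢1+n (trans (sym even) (key-snoc-𝟙 r even')))
  ... | inj₂ odd   = 𝟙-bottom odd

  extreme-completion : ∀ (r : Word Q) b → b < 2 → ∃[ c ] Extreme c × key Q (r ++ c ∷ []) % 2 ≡ b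
  extreme-completion r b b<2 with parity-cases (key Q r) | b | b<2
  ... | inj₁ even | 0 | _ = 𝟘 , inj₁ refl , trans (key-snoc-𝟘 r) even
  ... | inj₂ odd  | 1 | _ = 𝟘 , inj₁ refl , trans (key-snoc-𝟘 r) odd
  ... | inj₁ even | 1 | _ = 𝟙 , inj₂ refl , key-snoc-𝟙 r even
  ... | inj₂ odd  | 0 | _ = 𝟙 , inj₂ refl , key-snoc-𝟙 r odd
  ... | _ | suc (suc _) | s≤s (s≤s ())

  zeroPad-extreme : ∀ {c} → Extreme c → ∀ d → Extreme (zeroPad (c ∷ []) d)
  zeroPad-extreme ext zero    = ext
  zeroPad-extreme ext (suc d) = inj₁ refl

  candidate : Word Q → Fin Q → InfWord Q
  candidate r c = zeroPad (r ++ c ∷ [])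

  tail-parity : ∀ (r : Word Q) c d → key Q (r ++ take∞ (suc d) (zeroPad (c ∷ []))) % 2 ≡ key Q (r ++ c ∷ []) % 2
  tail-parity r c d = cong (_% 2) (begin
    key Q (r ++ c ∷ take∞ d (zeroPad []))   ≡⟨ cong (λ u → key Q (r ++ c ∷ u)) (take∞-zeros d) ⟩
    key Q (r ++ c ∷ replicate d 𝟘)          ≡⟨ cong (key Q) (sym (++-assoc r (c ∷ []) (replicate d 𝟘))) ⟩
    key Q ((r ++ c ∷ []) ++ replicate d 𝟘)  ≡⟨ key-pad (r ++ c ∷ []) d ⟩
    key Q (r ++ c ∷ [])                     ∎)
    where open ≡-Reasoning

  candidate-greatest : ∀ {r c} {w : InfWord Q} → Top r c → key Q (r ++ c ∷ []) % 2 ≡ 1 →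
    take∞ (length r) w ≡ r → ¬ Prec∞ Q (candidate r c) w
  candidate-greatest {r} {c} {w} top odd pw (_ , _ , differ , D)
    with difference-beyond-prefix r (take∞-zeroPad-prefix r (c ∷ [])) pw differ
  ... | d , refl = beyond d (subst₂ (λ s e → Decide Q s e (w (length r + d)))
                                    (take∞-zeroPad r (c ∷ []) d) (zeroPad-shift r (c ∷ []) d) D)
    where
      beyond : ∀ d' → Decide Q (r ++ take∞ d' (zeroPad (c ∷ []))) (zeroPad (c ∷ []) d') (w (length r + d)) → ⊥
      beyond zero     D' = top _ (subst (λ s → Decide Q s c (w (length r + d))) (++-identityʳ r) D')
      beyond (suc d') D' = 𝟘-top (trans (tail-parity r c d') odd) _ D'

  candidate-least : ∀ {r c} {w : InfWord Q} → Bottom r c → key Q (r ++ c ∷ []) % 2 ≡ 0 →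
    take∞ (length r) w ≡ r → ¬ Prec∞ Q w (candidate r c)
  candidate-least {r} {c} {w} bottom even pw (_ , same , differ , D)
    with difference-beyond-prefix r pw (take∞-zeroPad-prefix r (c ∷ [])) differ
  ... | d , refl = beyond d (subst₂ (λ s e → Decide Q s (w (length r + d)) e)
                                    (trans same (take∞-zeroPad r (c ∷ []) d)) (zeroPad-shift r (c ∷ []) d) D)
    where
      beyond : ∀ d' → Decide Q (r ++ take∞ d' (zeroPad (c ∷ []))) (w (length r + d)) (zeroPad (c ∷ []) d') → ⊥
      beyond zero     D' = bottom _ (subst (λ s → Decide Q s (w (length r + d)) c) (++-identityʳ r) D')
      beyond (suc d') D' = 𝟘-bottom (trans (tail-parity r c d') even) _ D'

  last-candidate : ∀ {f r c} {a : InfWord Q} → IsLast Q f r a → ¬ UltPeriod0 hQ a →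
    Top r c → key Q (r ++ c ∷ []) % 2 ≡ 1 → ¬ Avoids∞ f (candidate r c)
  last-candidate {r = r} {c} ((pa , _) , greatest) aperiodic top odd avoids
    with greatest (candidate r c) (take∞-zeroPad-prefix r (c ∷ []) , avoids)
  ... | inj₁ same  = aperiodic (UltPeriod0-resp {h = hQ} same (zeroPad-ultPeriod0 (r ++ c ∷ [])))
  ... | inj₂ below = candidate-greatest top odd pa below

  first-candidate : ∀ {f r c} {b : InfWord Q} → IsFirst Q f r b → ¬ UltPeriod0 hQ b →
    Bottom r c → key Q (r ++ c ∷ []) % 2 ≡ 0 → ¬ Avoids∞ f (candidate r c)
  first-candidate {r = r} {c} ((pb , _) , least) aperiodic bottom even avoids
    with least (candidate r c) (take∞-zeroPad-prefix r (c ∷ []) , avoids)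
  ... | inj₁ same  = aperiodic (UltPeriod0-resp {h = hQ} same (zeroPad-ultPeriod0 (r ++ c ∷ [])))
  ... | inj₂ above = candidate-least bottom even pb above

  TailFree : Word Q → Set
  TailFree f = ∀ {c} → Extreme c → ∀ d → take∞ (length f) (drop∞ d (zeroPad (c ∷ []))) ≢ f

  tail-free : ∀ {f : Word Q} → 2 ≤ length f →
    (∀ ℓ → 1 ≤ ℓ → f ≢ replicate ℓ (sym0 hQ)) →
    (∀ ℓ → 1 ≤ ℓ → f ≢ symLast hQ ∷ replicate ℓ (sym0 hQ)) → TailFree f
  tail-free {f} lf not-zeros not-𝟙-zeros ext d occ with length f | lf | d | ext
  ... | suc (suc L) | s≤s (s≤s _) | suc d | _ =
    not-zeros (suc (suc L)) (s≤s z≤n) (trans (sym occ) (take∞-zeros (suc (suc L))))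
  ... | suc (suc L) | s≤s (s≤s _) | zero | inj₁ refl =
    not-zeros (suc (suc L)) (s≤s z≤n) (trans (sym occ) (take∞-zeros (suc (suc L))))
  ... | suc (suc L) | s≤s (s≤s _) | zero | inj₂ refl =
    not-𝟙-zeros (suc L) (s≤s z≤n) (trans (sym occ) (cong (𝟙 ∷_) (take∞-zeros (suc L))))

  candidate-shift : ∀ (p : Word Q) x c i → candidate (p ++ x ∷ []) c (length p + i) ≡ zeroPad (x ∷ c ∷ []) i
  candidate-shift p x c i =
    trans (cong (λ u → zeroPad u (length p + i)) (++-assoc p (x ∷ []) (c ∷ []))) (zeroPad-shift p (x ∷ c ∷ []) i)

  straddle : ∀ {f p x c s} j → Extreme c → TailFree f → Avoids f (p ++ x ∷ s) →
    take∞ (length f) (drop∞ j (candidate (p ++ x ∷ []) c)) ≡ f →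
    ∃[ k ] j + k ≡ length p × 2 + k ≤ length f
  straddle {f} {p} {x} {c} {s} j ext free avoids occ with j ≤? length p
  ... | no j≰p with m≤n⇒∃[o]m+o≡n (≰⇒> j≰p)
  ...   | d , refl = ⊥-elim (free ext d (trans (sym (take∞-cong (length f) in-tail)) occ))
    where
      regroup : ∀ a b i → suc a + b + i ≡ a + suc (b + i)
      regroup = solve-∀
      in-tail : drop∞ (suc (length p) + d) (candidate (p ++ x ∷ []) c) ≐ drop∞ d (zeroPad (c ∷ []))
      in-tail i = trans (cong (candidate (p ++ x ∷ []) c) (regroup (length p) d i)) (candidate-shift p x c (suc (d + i)))
  straddle {f} {p} {x} {c} {s} j ext free avoids occ | yes j≤p with m≤n⇒∃[o]m+o≡n j≤p
  ... | k , ek with 2 + k ≤? length f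
  ...   | yes fits = k , ek , fits
  ...   | no short = ⊥-elim (avoids (subst (FactorOf f) (++-assoc p (x ∷ []) s) (factor-extend s inside-px)))
    where
      ends-by-x : j + length f ≤ length p + 1
      ends-by-x = ≤-trans (+-monoʳ-≤ j (m<1+n⇒m≤n (≰⇒> short)))
                          (≤-reflexive (trans (+-suc j k) (trans (cong suc ek) (+-comm 1 (length p)))))
      prefix-px : take∞ (length p + 1) (candidate (p ++ x ∷ []) c) ≡ p ++ x ∷ []
      prefix-px = subst (λ n → take∞ n (candidate (p ++ x ∷ []) c) ≡ p ++ x ∷ [])
                        (length-++ p) (take∞-zeroPad-prefix (p ++ x ∷ []) (c ∷ []))
      inside-px : FactorOf f (p ++ x ∷ [])
      inside-px = subst (FactorOf f) prefix-px (occurrence-in-prefix j (length p + 1) ends-by-x occ)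

  aligned-letters : ∀ {p : Word Q} {x y c c' j j' k L} e → j + k ≡ length p → 2 + k ≤ L →
    take∞ L (drop∞ j (candidate (p ++ x ∷ []) c)) ≡ take∞ L (drop∞ j' (candidate (p ++ y ∷ []) c')) →
    j + e ≡ j' → ∀ i → i < 2 → zeroPad (x ∷ c ∷ []) i ≡ zeroPad (y ∷ c' ∷ []) (i + e)
  aligned-letters {p} {x} {y} {c} {c'} {j} {j'} {k} {L} e ek fits same refl i i<2 = begin
    zeroPad (x ∷ c ∷ []) i        ≡⟨ sym (at-offset x c i) ⟩
    u (j + k + i)                 ≡⟨ cong u (regroupˡ j k i) ⟩
    u (j + (i + k))               ≡⟨ take∞-agree L _ _ same (i + k) (≤-trans (+-monoˡ-< k i<2) fits) ⟩
    v (j + e + (i + k))           ≡⟨ cong v (regroupʳ j e i k) ⟩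
    v (j + k + (i + e))           ≡⟨ at-offset y c' (i + e) ⟩
    zeroPad (y ∷ c' ∷ []) (i + e) ∎
    where
      open ≡-Reasoning
      u v : InfWord Q
      u = candidate (p ++ x ∷ []) c
      v = candidate (p ++ y ∷ []) c'
      at-offset : ∀ z c″ t → candidate (p ++ z ∷ []) c″ (j + k + t) ≡ zeroPad (z ∷ c″ ∷ []) t
      at-offset z c″ t = trans (cong (λ n → candidate (p ++ z ∷ []) c″ (n + t)) ek) (candidate-shift p z c″ t)
      regroupˡ : ∀ a b i → a + b + i ≡ a + (i + b)
      regroupˡ = solve-∀
      regroupʳ : ∀ a e i b → a + e + (i + b) ≡ a + b + (i + e)
      regroupʳ = solve-∀

  -- Of two straddling occurrences of one word, a strictly earlier one has c = 𝟘 and faces,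
  -- with its x, a letter of c' 0^∞; so x is extreme.
  earlier-occurrence : ∀ {p : Word Q} {x y c c' j j' k L} → Extreme c' → j < j' →
    j + k ≡ length p → 2 + k ≤ L →
    take∞ L (drop∞ j (candidate (p ++ x ∷ []) c)) ≡ take∞ L (drop∞ j' (candidate (p ++ y ∷ []) c')) →
    c ≡ 𝟘 × Extreme x
  earlier-occurrence {p} {x} {y} {c} {c'} {j} ext' j<j' ek fits same with m≤n⇒∃[o]m+o≡n j<j'
  ... | d , j'≡ = aligned 1 (s≤s (s≤s z≤n)) , subst Extreme (sym (aligned 0 (s≤s z≤n))) (zeroPad-extreme ext' d)
    where
      aligned : ∀ i → i < 2 → zeroPad (x ∷ c ∷ []) i ≡ zeroPad (y ∷ c' ∷ []) (i + suc d)
      aligned = aligned-letters {p} (suc d) ek fits same (trans (+-suc j d) j'≡)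

  compare-occurrences : ∀ {p : Word Q} {x y c c' j j' k k' L} → Extreme c → Extreme c' →
    j + k ≡ length p → j' + k' ≡ length p → 2 + k ≤ L → 2 + k' ≤ L →
    take∞ L (drop∞ j (candidate (p ++ x ∷ []) c)) ≡ take∞ L (drop∞ j' (candidate (p ++ y ∷ []) c')) →
    x ≢ y → (c ≡ 𝟘 × Extreme x) ⊎ (c' ≡ 𝟘 × Extreme y)
  compare-occurrences {p} {j = j} {j'} ext ext' ek ek' fits fits' same xy with <-cmp j j'
  ... | tri< j<j' _ _ = inj₁ (earlier-occurrence {p} ext' j<j' ek fits same)
  ... | tri≈ _ refl _ = ⊥-elim (xy (aligned-letters {p} 0 ek fits same (+-identityʳ j) 0 (s≤s z≤n)))
  ... | tri> _ _ j'<j = inj₂ (earlier-occurrence {p} ext j'<j ek' fits' (sym same))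

  no-two-aperiodic : ∀ {f : Word Q} → 2 ≤ length f →
    (∀ ℓ → 1 ≤ ℓ → f ≢ replicate ℓ (sym0 hQ)) →
    (∀ ℓ → 1 ≤ ℓ → f ≢ symLast hQ ∷ replicate ℓ (sym0 hQ)) →
    ∀ {n a b p x y s t} {a'' b'' : InfWord Q} → Consecutive Q n f a b →
    a ≡ p ++ x ∷ s → b ≡ p ++ y ∷ t → x ≢ y →
    IsLast Q f (p ++ x ∷ []) a'' → IsFirst Q f (p ++ y ∷ []) b'' →
    ¬ UltPeriod0 hQ a'' → ¬ UltPeriod0 hQ b'' → ⊥
  no-two-aperiodic {f} lf not-zeros not-𝟙-zeros {p = p} {x} {y} {s} {t} (_ , avoidsA , _ , avoidsB , prec , _)
                   refl refl xy last first na nb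
    with extreme-completion (p ++ x ∷ []) 1 (s≤s (s≤s z≤n)) | extreme-completion (p ++ y ∷ []) 0 (s≤s z≤n)
  ... | cA , extA , oddA | cB , extB , evenB =
    last-candidate last na (extreme-top extA oddA) oddA λ { (j , occA) →
    first-candidate first nb (extreme-bottom extB evenB) evenB λ { (j' , occB) →
      let (k  , ek  , fits)  = straddle {p = p} {x} {s = s} j  extA free avoidsA occA
          (k' , ek' , fits') = straddle {p = p} {y} {s = t} j' extB free avoidsB occB
      in refute (compare-occurrences {p = p} extA extB ek ek' fits fits' (trans occA (sym occB)) xy) } }
    where
      D : Decide Q p x y
      D = prec-at-first-difference prec refl refl xy
      free : TailFree f
      free = tail-free lf not-zeros not-𝟙-zeros
      refute : (cA ≡ 𝟘 × Extreme x) ⊎ (cB ≡ 𝟘 × Extreme y) → ⊥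
      refute (inj₁ (refl , extX)) = extreme-top    extX (trans (sym (key-snoc-𝟘 _)) oddA)  y D
      refute (inj₂ (refl , extY)) = extreme-bottom extY (trans (sym (key-snoc-𝟘 _)) evenB) x D

proposition15 : (q : ℕ) (hq : 2 ≤ q) (f : Word q) →
    2 ≤ length f →
    ¬ InducesZeroPeriodicity q hq f →
    (∀ ℓ → 1 ≤ ℓ → f ≢ replicate ℓ (sym0 hq)) →
    (∀ ℓ → 1 ≤ ℓ → f ≢ symLast hq ∷ replicate ℓ (sym0 hq)) →
    (n : ℕ) → 1 ≤ n →
    (a b : Word q) → Consecutive q n f a b →
    (p : Word q) (x y : Fin q) (s t : Word q) →
    a ≡ p ++ x ∷ s → b ≡ p ++ y ∷ t → x ≢ y →
    (a'' b'' : InfWord q) →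
    IsLast q f (p ++ x ∷ []) a'' → IsFirst q f (p ++ y ∷ []) b'' →
    ¬ (¬ UltPeriod0 hq a'' × ¬ UltPeriod0 hq b'')
proposition15 (suc (suc m)) (s≤s (s≤s z≤n)) f lf _ not-zeros not-𝟙-zeros n _ a b consecutive
              p x y s t ea eb xy a'' b'' last first (na , nb) =
  Alphabet.no-two-aperiodic m lf not-zeros not-𝟙-zeros consecutive ea eb xy last first na nb
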